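{- Let $\mathcal{S}_Z=(s_Z(n)\bmod 2)_{n\ge 0}$, where $s_Z(n)$ is the sum of digits of $n$ in the Zeckendorf numeration system, and let $\varphi=(1+\sqrt5)/2$. There exists $N_0>0$ such that for all integers $N>N_0$, \[ M(\mathcal{S}_Z,N)\ \ge\ \frac{1}{\varphi+\varphi^3}\,N+1, \] where $M(\mathcal{S},N)$ denotes the $N$th maximum order complexity.
   Context: Fibonacci numbers: $F_0=0$, $F_1=1$, $F_{n+2}=F_{n+1}+F_n$. Every integer $n\ge 0$ has a unique Zeckendorf representation $n=\sum_{i\ge0}\varepsilon_i(n)F_{i+2}$ with $\varepsilon_i(n)\in\{0,1\}$ and $\varepsilon_i(n)\varepsilon_{i+1}(n)=0$ for all $i$; set $s_Z(n)=\sum_{i\ge0}\varepsilon_i(n)$. Maximum order complexity: for a binary sequence $\mathcal{S}=(s_n)_{n\ge0}$ over $\{0,1\}=\mathbb{F}_2$ and an integer $N\ge2$ with $(s_0,\dots,s_{N-2})$ not constant, $M(\mathcal{S},N)$ is the smallest positive integer $M$ such that there is a polynomial $f\in\mathbb{F}_2[x_1,\dots,x_M]$ with $s_{i+M}=f(s_i,\dots,s_{i+M-1})$ for all $0\le i\le N-M-1$. If $s_0=\dots=s_{N-2}=a$, then $M(\mathcal{S},N)=0$ if $s_{N-1}=a$ and $M(\mathcal{S},N)=N-1$ otherwise. -}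

module Defs where

open import Data.Nat using (ℕ; zero; suc; _+_; _*_; _∸_; _≤_; _<_; _≤?_; _%_; _≡ᵇ_)
open import Data.Bool using (Bool; true; false; if_then_else_; _xor_; _∧_)
open import Data.Fin using (Fin; toℕ)
open import Data.Vec using (Vec; lookup; tabulate)
open import Data.List using (List; []; _∷_)
open import Data.Product using (Σ; _×_; ∃)
open import Data.Sum using (_⊎_)
open import Relation.Nullary using (¬_; does)
open import Relation.Binary.PropositionalEquality using (_≡_)

fib : ℕ → ℕ
fib zero = 0
fib (suc zero) = 1
fib (suc (suc n)) = fib (suc n) + fib n

-- Greedy computation of Zeckendorf digits:
-- zeckGo k r = [ε_{k-1}, …, ε_0] (big-endian) of the Zeckendorf
-- representation of r using F_{k+1}, …, F_2 (requires r < F_{k+2}).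
zeckGo : ℕ → ℕ → List Bool
zeckGo zero r = []
zeckGo (suc k) r =
  if does (fib (k + 2) ≤? r)
  then true ∷ zeckGo k (r ∸ fib (k + 2))
  else false ∷ zeckGo k r

-- Zeckendorf digits of n (since n < F_{n+3}, indices 0..n suffice)
zeckDigits : ℕ → List Bool
zeckDigits n = zeckGo (suc n) n

countTrue : List Bool → ℕ
countTrue [] = 0
countTrue (true ∷ xs) = suc (countTrue xs)
countTrue (false ∷ xs) = countTrue xs

sZ : ℕ → ℕ
sZ n = countTrue (zeckDigits n)

-- The binary sequence S_Z = (s_Z(n) mod 2), with F_2 = Bool (true = 1)
SZ : ℕ → Bool
SZ n = (sZ n % 2) ≡ᵇ 1

-- Polynomials in F_2[x_1, …, x_m] (as formal expressions) and evaluation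
data Poly (m : ℕ) : Set where
  var  : Fin m → Poly m
  con  : Bool → Poly m
  _⊕_  : Poly m → Poly m → Poly m
  _⊗_  : Poly m → Poly m → Poly m

eval : ∀ {m} → Poly m → Vec Bool m → Bool
eval (var i) v = lookup v i
eval (con b) v = b
eval (p ⊕ q) v = eval p v xor eval q v
eval (p ⊗ q) v = eval p v ∧ eval q v

window : (ℕ → Bool) → (M i : ℕ) → Vec Bool M
window s M i = tabulate (λ k → s (i + toℕ k))

Generates : (ℕ → Bool) → (N M : ℕ) → Set
Generates s N M = Σ (Poly M) λ f → ∀ i → i + M < N → s (i + M) ≡ eval f (window s M i)

InitConst : (ℕ → Bool) → ℕ → Set
InitConst s N = ∀ i → i < N ∸ 1 → s i ≡ s 0

-- M is the N-th maximum order complexity M(S, N) (for N ≥ 2)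
IsMOC : (ℕ → Bool) → (N M : ℕ) → Set
IsMOC s N M =
  (InitConst s N × ((s (N ∸ 1) ≡ s 0 × M ≡ 0) ⊎ (¬ (s (N ∸ 1) ≡ s 0) × M ≡ N ∸ 1)))
  ⊎ (¬ InitConst s N × (1 ≤ M × Generates s N M × (∀ M' → 1 ≤ M' → Generates s N M' → M ≤ M')))

-- M ≥ N/(φ+φ³) + 1, where 1/(φ+φ³) = (3√5 − 5)/10.
-- Equivalently 10M + 5N ≥ 10 + 3√5·N, i.e. (with A = 10M + 5N)
-- A ≥ 10 and (A − 10)² ≥ 45 N².
BoundHolds : (N M : ℕ) → Set
BoundHolds N M = 10 ≤ A × 45 * (N * N) ≤ (A ∸ 10) * (A ∸ 10)
  where A = 10 * M + 5 * N

module Submission where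

open import Defs
open import Data.Bool using (Bool; true; false; not; T; _xor_; _∧_)
open import Data.Bool.Properties using (not-involutive; xor-identityʳ) renaming (_≟_ to _≟ᴮ_)
open import Data.Empty using (⊥-elim)
open import Data.Fin as Fin using (Fin; toℕ)
open import Data.Fin.Properties using (toℕ<n)
open import Data.List using (_∷_)
open import Data.Unit using (tt)
open import Data.Nat
open import Data.Nat.Properties
open import Data.Nat.Tactic.RingSolver using (solve-∀)
open import Data.Product using (Σ; ∃; ∃₂; _×_; _,_)
open import Data.Sum using (inj₁; inj₂)
open import Data.Vec using (Vec; []; _∷_)
open import Data.Vec.Properties using (≡-dec; tabulate-cong)
open import Function using (_∘_)
open import Relation.Nullary using (¬_; Dec; yes; no; contradiction)
open import Relation.Nullary.Decidable using (map′; _×-dec_; _→-dec_)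
open import Relation.Binary.PropositionalEquality

-- The digit sum satisfies s_Z(F_{a+2} + t) = s_Z(t) + 1 for t < F_{a+1}, so the parity
-- sequence on [F_{a+2}, F_{a+2} + F_{a+1}) is the complement of its initial segment.  Hence
-- the windows of length F_{b+2} starting at F_{b+3} and at F_{b+4} coincide while the terms
-- after them differ; for even b both windows extend one step to the left, because
-- s_Z(F_{n+1} - 1) and s_Z(F_{n+2} - 1) have the same parity for even n.  Such a
-- conflict forces M(S_Z, N) to exceed its length once N > F_{b+4} + F_{b+2}, and Cassini's
-- identity shows that this length is at least N/(φ+φ³) up to the next threshold
-- F_{b+5} + F_{b+3}.

fib-pos : ∀ n → 0 < fib (suc n)
fib-pos zero    = s≤s z≤n
fib-pos (suc n) = ≤-trans (fib-pos n) (m≤m+n _ _)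

fib-mono-suc : ∀ n → fib n ≤ fib (suc n)
fib-mono-suc zero    = z≤n
fib-mono-suc (suc n) = m≤m+n (fib (suc n)) (fib n)

fib-mono-≤′ : ∀ {m n} → m ≤′ n → fib m ≤ fib n
fib-mono-≤′ ≤′-refl           = ≤-refl
fib-mono-≤′ (≤′-step {n} p) = ≤-trans (fib-mono-≤′ p) (fib-mono-suc n)

fib-<-suc : ∀ n → fib (2 + n) < fib (3 + n)
fib-<-suc n = m<m+n (fib (2 + n)) (fib-pos n)

n<fib[2+n] : ∀ n → n < fib (2 + n)
n<fib[2+n] zero    = s≤s z≤n
n<fib[2+n] (suc n) = subst (_≤ fib (3 + n)) (+-comm (suc n) 1) (+-mono-≤ (n<fib[2+n] n) (fib-pos n))

suc-pred-fib : ∀ n → suc (pred (fib (suc n))) ≡ fib (suc n)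
suc-pred-fib n = suc-pred (fib (suc n)) {{>-nonZero (fib-pos n)}}

-- Zeckendorf digit sums

zeckGo-leading-false : ∀ k {r} → r < fib (2 + k) → zeckGo (suc k) r ≡ false ∷ zeckGo k r
zeckGo-leading-false k {r} r< with fib (k + 2) ≤ᵇ r in test
... | false = refl
... | true  = contradiction (≤ᵇ⇒≤ _ _ (subst T (sym test) tt)) (<⇒≱ (subst (r <_) (cong fib (+-comm 2 k)) r<))

zeckGo-leading-true : ∀ k {r} → fib (2 + k) ≤ r →
                      zeckGo (suc k) r ≡ true ∷ zeckGo k (r ∸ fib (2 + k))
zeckGo-leading-true k {r} F≤r with fib (k + 2) ≤ᵇ r in test
... | true  = cong (λ F → true ∷ zeckGo k (r ∸ F)) (cong fib (+-comm k 2))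
... | false = ⊥-elim (subst T test (≤⇒≤ᵇ (subst (_≤ r) (cong fib (+-comm 2 k)) F≤r)))

countTrue-zeckGo-pad : ∀ {k k′ r} → k ≤′ k′ → r < fib (2 + k) →
                       countTrue (zeckGo k′ r) ≡ countTrue (zeckGo k r)
countTrue-zeckGo-pad ≤′-refl             _  = refl
countTrue-zeckGo-pad (≤′-step {k′} p) r< = trans
  (cong countTrue (zeckGo-leading-false k′ (<-≤-trans r< (fib-mono-≤′ (s≤′s (s≤′s p))))))
  (countTrue-zeckGo-pad p r<)

sZ-zeckGo : ∀ k {r} → r < fib (2 + k) → sZ r ≡ countTrue (zeckGo k r)
sZ-zeckGo k {r} r< with ≤-total k (suc r)
... | inj₁ k≤ = countTrue-zeckGo-pad (≤⇒≤′ k≤) r<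
... | inj₂ ≤k = sym (countTrue-zeckGo-pad (≤⇒≤′ ≤k)
                      (<-≤-trans (n<fib[2+n] r) (fib-mono-suc (2 + r))))

sZ-fib-+ : ∀ a {t} → t < fib (1 + a) → sZ (fib (2 + a) + t) ≡ suc (sZ t)
sZ-fib-+ a {t} t< = begin
  sZ (F + t)                                 ≡⟨ sZ-zeckGo (suc a) (+-monoʳ-< F t<) ⟩
  countTrue (zeckGo (suc a) (F + t))         ≡⟨ cong countTrue (zeckGo-leading-true a (m≤m+n F t)) ⟩
  suc (countTrue (zeckGo a (F + t ∸ F)))     ≡⟨ cong (suc ∘ countTrue ∘ zeckGo a) (m+n∸m≡n F t) ⟩
  suc (countTrue (zeckGo a t))               ≡⟨ cong suc (sym (sZ-zeckGo a (<-≤-trans t< (fib-mono-suc (1 + a))))) ⟩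
  suc (sZ t)                                 ∎
  where
  open ≡-Reasoning
  F = fib (2 + a)

odd : ℕ → Bool
odd n = n % 2 ≡ᵇ 1

odd-suc : ∀ n → odd (suc n) ≡ not (odd n)
odd-suc zero          = refl
odd-suc (suc zero)    = refl
odd-suc (suc (suc n)) = odd-suc n

odd-suc-suc : ∀ n → odd (2 + n) ≡ odd n
odd-suc-suc n = trans (odd-suc (suc n)) (trans (cong not (odd-suc n)) (not-involutive (odd n)))

SZ-fib-+ : ∀ a {t} → t < fib (1 + a) → SZ (fib (2 + a) + t) ≡ not (SZ t)
SZ-fib-+ a {t} t< = trans (cong odd (sZ-fib-+ a t<)) (odd-suc (sZ t))

SZ-fib : ∀ a → SZ (fib (2 + a)) ≡ true
SZ-fib a = trans (cong SZ (sym (+-identityʳ (fib (2 + a))))) (SZ-fib-+ a (fib-pos a))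

pred-+ : ∀ m {n} → 0 < n → pred (m + n) ≡ m + pred n
pred-+ m {suc n} _ = cong pred (+-suc m n)

SZ-pred-fib-suc-suc : ∀ n → SZ (pred (fib (3 + n))) ≡ not (SZ (pred (fib (1 + n))))
SZ-pred-fib-suc-suc n = trans (cong SZ (pred-+ (fib (2 + n)) (fib-pos n)))
                              (SZ-fib-+ n (subst (_≤ fib (1 + n)) (sym (suc-pred-fib n)) ≤-refl))

SZ-pred-fib : ∀ n → odd n ≡ false → SZ (pred (fib (1 + n))) ≡ SZ (pred (fib (2 + n)))
SZ-pred-fib zero          _    = refl
SZ-pred-fib (suc zero)    ()
SZ-pred-fib (suc (suc n)) even = begin
  SZ (pred (fib (3 + n)))       ≡⟨ SZ-pred-fib-suc-suc n ⟩
  not (SZ (pred (fib (1 + n)))) ≡⟨ cong not (SZ-pred-fib n (trans (sym (odd-suc-suc n)) even)) ⟩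
  not (SZ (pred (fib (2 + n)))) ≡⟨ sym (SZ-pred-fib-suc-suc (suc n)) ⟩
  SZ (pred (fib (4 + n)))       ∎
  where open ≡-Reasoning

SZ-nonconstant : ∀ {N} → 2 < N → ¬ InitConst SZ N
SZ-nonconstant (s≤s (s≤s (s≤s _))) const with const 1 (s≤s (s≤s z≤n))
... | ()

-- Generating polynomials

weaken : ∀ {m} → Poly m → Poly (suc m)
weaken (var i) = var (Fin.suc i)
weaken (con b) = con b
weaken (p ⊕ q) = weaken p ⊕ weaken q
weaken (p ⊗ q) = weaken p ⊗ weaken q

eval-weaken : ∀ {m} (p : Poly m) x v → eval (weaken p) (x ∷ v) ≡ eval p v
eval-weaken (var i) x v = refl
eval-weaken (con b) x v = refl
eval-weaken (p ⊕ q) x v = cong₂ _xor_ (eval-weaken p x v) (eval-weaken q x v)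
eval-weaken (p ⊗ q) x v = cong₂ _∧_ (eval-weaken p x v) (eval-weaken q x v)

interpolate : ∀ {m} → (Vec Bool m → Bool) → Poly m
interpolate {zero}  h = con (h [])
interpolate {suc m} h = ((var Fin.zero ⊕ con true) ⊗ weaken (interpolate (h ∘ (false ∷_))))
                      ⊕ (var Fin.zero ⊗ weaken (interpolate (h ∘ (true ∷_))))

eval-interpolate : ∀ {m} (h : Vec Bool m → Bool) v → eval (interpolate h) v ≡ h v
eval-interpolate {zero}  h []         = refl
eval-interpolate {suc m} h (true ∷ v)  =
  trans (eval-weaken (interpolate (h ∘ (true ∷_))) true v) (eval-interpolate (h ∘ (true ∷_)) v)
eval-interpolate {suc m} h (false ∷ v) = trans (xor-identityʳ _)
  (trans (eval-weaken (interpolate (h ∘ (false ∷_))) false v) (eval-interpolate (h ∘ (false ∷_)) v))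

Consistent : (ℕ → Bool) → (N M : ℕ) → Set
Consistent s N M = ∀ {i j} → i + M < N → j + M < N →
                   window s M i ≡ window s M j → s (i + M) ≡ s (j + M)

generates⇒consistent : ∀ {s N M} → Generates s N M → Consistent s N M
generates⇒consistent (f , gen) {i} {j} i-fits j-fits w =
  trans (gen i i-fits) (trans (cong (eval f) w) (sym (gen j j-fits)))

consistent⇒generates : ∀ {s N M} → Consistent s N M → Generates s N M
consistent⇒generates {s} {N} {M} consistent =
  interpolate next , λ j j-fits → sym (trans (eval-interpolate next (window s M j)) (next-window j-fits))
  where
  occurs? : ∀ v i → Dec (i + M < N × window s M i ≡ v)
  occurs? v i = (i + M <? N) ×-dec ≡-dec _≟ᴮ_ (window s M i) v

  next : Vec Bool M → Bool
  next v with anyUpTo? (occurs? v) N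
  ... | yes (i , _ , _) = s (i + M)
  ... | no  _           = false

  next-window : ∀ {j} → j + M < N → next (window s M j) ≡ s (j + M)
  next-window {j} j-fits with anyUpTo? (occurs? (window s M j)) N
  ... | yes (i , _ , i-fits , w) = consistent i-fits j-fits w
  ... | no  none                 = contradiction (j , ≤-<-trans (m≤m+n j M) j-fits , j-fits , refl) none

consistent? : ∀ s N M → Dec (Consistent s N M)
consistent? s N M = map′ (λ c i-fits j-fits → c (fits⇒< i-fits) (fits⇒< j-fits) i-fits j-fits)
                         (λ c {i} _ {j} _ → c {i} {j})
                         (allUpTo? (λ i → allUpTo? (λ j → pair? i j) N) N)
  where
  fits⇒< : ∀ {i} → i + M < N → i < N
  fits⇒< {i} = ≤-<-trans (m≤m+n i M)

  pair? : ∀ i j → Dec (i + M < N → j + M < N → window s M i ≡ window s M j → s (i + M) ≡ s (j + M))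
  pair? i j = (i + M <? N) →-dec ((j + M <? N) →-dec
              (≡-dec _≟ᴮ_ (window s M i) (window s M j) →-dec (s (i + M) ≟ᴮ s (j + M))))

generates? : ∀ s N M → Dec (Generates s N M)
generates? s N M = map′ (consistent⇒generates {s}) (generates⇒consistent {s}) (consistent? s N M)

generates-≥ : ∀ {s N M} → N ≤ M → Generates s N M
generates-≥ {M = M} N≤M = con false , λ i i-fits → contradiction (≤-trans N≤M (m≤n+m M i)) (<⇒≱ i-fits)

least-witness : ∀ {P : ℕ → Set} → (∀ n → Dec (P n)) → ∀ {n} → P n →
                ∃ λ m → P m × (∀ {k} → P k → m ≤ k)
least-witness P? {n} Pn with P? 0
... | yes P0 = 0 , P0 , λ _ → z≤n
least-witness P? {zero}  P0 | no ¬P0 = contradiction P0 ¬P0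
least-witness P? {suc n} Pn | no ¬P0 with least-witness (P? ∘ suc) Pn
... | m , Pm , least = suc m , Pm , λ { {zero} P0 → contradiction P0 ¬P0 ; {suc k} Pk → s≤s (least Pk) }

least-generating-order : ∀ s N → Σ ℕ λ M → 1 ≤ M × Generates s N M ×
                         (∀ M′ → 1 ≤ M′ → Generates s N M′ → M ≤ M′)
least-generating-order s N with least-witness (generates? s N ∘ suc) (generates-≥ {s} (n≤1+n N))
... | m , gen , least = suc m , s≤s z≤n , gen , λ { zero () ; (suc k) _ g → s≤s (least g) }

-- Conflicts

record ConflictAt (s : ℕ → Bool) (N L i j : ℕ) : Set where
  constructor conflict
  field
    left-fits  : i + L < N
    right-fits : j + L < N
    agree      : ∀ {t} → t < L → s (i + t) ≡ s (j + t)
    differ     : s (i + L) ≢ s (j + L)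

conflict-blocks : ∀ {s N d M i j} → ConflictAt s N (d + M) i j → ¬ Generates s N M
conflict-blocks {s} {N} {d} {M} {i} {j} (conflict i-fits j-fits agree differ) (f , gen) = differ (begin
  s (i + (d + M))             ≡⟨ cong s (sym (+-assoc i d M)) ⟩
  s (i + d + M)               ≡⟨ gen (i + d) (subst (_< N) (sym (+-assoc i d M)) i-fits) ⟩
  eval f (window s M (i + d)) ≡⟨ cong (eval f) (tabulate-cong shifted-agree) ⟩
  eval f (window s M (j + d)) ≡⟨ sym (gen (j + d) (subst (_< N) (sym (+-assoc j d M)) j-fits)) ⟩
  s (j + d + M)               ≡⟨ cong s (+-assoc j d M) ⟩
  s (j + (d + M))             ∎)
  where
  open ≡-Reasoning
  shifted-agree : ∀ (k : Fin M) → s (i + d + toℕ k) ≡ s (j + d + toℕ k)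
  shifted-agree k = subst₂ (λ a b → s a ≡ s b) (sym (+-assoc i d (toℕ k))) (sym (+-assoc j d (toℕ k)))
                           (agree (+-monoʳ-< d (toℕ<n k)))

conflict⇒order> : ∀ {s N L M i j} → ConflictAt s N L i j → Generates s N M → L < M
conflict⇒order> {s} {N} {L} {M} {i} {j} c gen with M ≤? L
... | no  M≰L = ≰⇒> M≰L
... | yes M≤L = contradiction gen
                  (conflict-blocks (subst (λ L → ConflictAt s N L i j) (sym (m∸n+n≡m M≤L)) c))

conflict-extendˡ : ∀ {s N L i j} → ConflictAt s N L (suc i) (suc j) → s i ≡ s j →
                   ConflictAt s N (suc L) i j
conflict-extendˡ {s} {N} {L} {i} {j} (conflict i-fits j-fits agree differ) si≡sj = conflict
  (subst (_< N) (sym (+-suc i L)) i-fits)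
  (subst (_< N) (sym (+-suc j L)) j-fits)
  agree′
  (λ e → differ (subst₂ (λ a b → s a ≡ s b) (+-suc i L) (+-suc j L) e))
  where
  agree′ : ∀ {t} → t < suc L → s (i + t) ≡ s (j + t)
  agree′ {zero}  _          rewrite +-identityʳ i | +-identityʳ j = si≡sj
  agree′ {suc t} (s≤s t<L) rewrite +-suc i t     | +-suc j t     = agree t<L

conflictEnd : ℕ → ℕ
conflictEnd b = fib (4 + b) + fib (2 + b)

conflictEnd-increasing : ∀ b → conflictEnd b < conflictEnd (suc b)
conflictEnd-increasing b = +-mono-≤-< (fib-mono-suc (4 + b)) (fib-<-suc b)

SZ-conflict : ∀ b {N} → conflictEnd b < N → ConflictAt SZ N (fib (2 + b)) (fib (3 + b)) (fib (4 + b))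
SZ-conflict b end<N = conflict
  (≤-<-trans (+-monoˡ-≤ (fib (2 + b)) (fib-mono-suc (3 + b))) end<N)
  end<N
  (λ t< → trans (SZ-fib-+ (1 + b) t<) (sym (SZ-fib-+ (2 + b) (<-≤-trans t< (fib-mono-suc (2 + b))))))
  (λ e → true≢false (begin
    true                                  ≡⟨ sym (SZ-fib (2 + b)) ⟩
    SZ (fib (4 + b))                      ≡⟨ e ⟩
    SZ (fib (4 + b) + fib (2 + b))        ≡⟨ SZ-fib-+ (2 + b) (fib-<-suc b) ⟩
    not (SZ (fib (2 + b)))                ≡⟨ cong not (SZ-fib b) ⟩
    false                                 ∎))
  where
  open ≡-Reasoning
  true≢false : true ≢ false
  true≢false ()

SZ-conflict-extended : ∀ b {N} → odd (2 + b) ≡ false → conflictEnd b < N →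
                       ConflictAt SZ N (suc (fib (2 + b))) (pred (fib (3 + b))) (pred (fib (4 + b)))
SZ-conflict-extended b {N} even end<N = conflict-extendˡ
  (subst₂ (ConflictAt SZ N (fib (2 + b))) (sym (suc-pred-fib (2 + b))) (sym (suc-pred-fib (3 + b)))
          (SZ-conflict b end<N))
  (SZ-pred-fib (2 + b) even)

-- Cassini's identity and the slope bound

Cassini : Bool → ℕ → ℕ → Set
Cassini false x y = x * (y + x) + 1 ≡ y * y
Cassini true  x y = x * (y + x) ≡ y * y + 1

cassini-step : ∀ {b x y} → Cassini b x y → Cassini (not b) y (y + x)
cassini-step {false} {x} {y} h = +-cancelʳ-≡ (y * y) _ _ (begin
  y * ((y + x) + y) + y * y             ≡⟨ cong (y * ((y + x) + y) +_) (sym h) ⟩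
  y * ((y + x) + y) + (x * (y + x) + 1) ≡⟨ rearrange x y ⟩
  ((y + x) * (y + x) + 1) + y * y       ∎)
  where
  open ≡-Reasoning
  rearrange : ∀ x y → y * ((y + x) + y) + (x * (y + x) + 1) ≡ ((y + x) * (y + x) + 1) + y * y
  rearrange = solve-∀
cassini-step {true} {x} {y} h = +-cancelʳ-≡ (y * y) _ _ (begin
  (y * ((y + x) + y) + 1) + y * y ≡⟨ +-assoc (y * ((y + x) + y)) 1 (y * y) ⟩
  y * ((y + x) + y) + (1 + y * y) ≡⟨ cong (y * ((y + x) + y) +_) (trans (+-comm 1 (y * y)) (sym h)) ⟩
  y * ((y + x) + y) + x * (y + x) ≡⟨ rearrange x y ⟩
  (y + x) * (y + x) + y * y       ∎)
  where
  open ≡-Reasoning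
  rearrange : ∀ x y → y * ((y + x) + y) + x * (y + x) ≡ (y + x) * (y + x) + y * y
  rearrange = solve-∀

cassini : ∀ n → Cassini (odd n) (fib n) (fib (suc n))
cassini zero = refl
cassini (suc n) rewrite odd-suc n = cassini-step (cassini n)

-- SlopeBound N L says L ≥ N/(φ+φ³), i.e. 10 L + 5 N ≥ 3√5 N, squared.
SlopeBound : ℕ → ℕ → Set
SlopeBound N L = 45 * (N * N) ≤ (10 * L + 5 * N) * (10 * L + 5 * N)

-- As 5 < √45 < 7: either X ≥ 7N, or 10dX + 25d² stays below 90Nd + 45d².
√45-bound-descends : ∀ N d X → 45 * ((N + d) * (N + d)) ≤ (X + 5 * d) * (X + 5 * d) →
                     45 * (N * N) ≤ X * X
√45-bound-descends N d X bound with 7 * N ≤? X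
... | yes 7N≤X = begin
  45 * (N * N)      ≤⟨ *-monoˡ-≤ (N * N) (m≤m+n 45 4) ⟩
  49 * (N * N)      ≡⟨ square-7 N ⟩
  (7 * N) * (7 * N) ≤⟨ *-mono-≤ 7N≤X 7N≤X ⟩
  X * X             ∎
  where
  open ≤-Reasoning
  square-7 : ∀ N → 49 * (N * N) ≡ (7 * N) * (7 * N)
  square-7 = solve-∀
... | no  7N≰X = +-cancelʳ-≤ (d * (90 * N + 45 * d)) _ _ (begin
  45 * (N * N) + d * (90 * N + 45 * d) ≡⟨ expand-left N d ⟩
  45 * ((N + d) * (N + d))             ≤⟨ bound ⟩
  (X + 5 * d) * (X + 5 * d)            ≡⟨ expand-right X d ⟩
  X * X + d * (10 * X + 25 * d)        ≤⟨ +-monoʳ-≤ (X * X) (*-monoʳ-≤ d (+-mono-≤ 10X≤90N 25d≤45d)) ⟩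
  X * X + d * (90 * N + 45 * d)        ∎)
  where
  open ≤-Reasoning
  expand-left : ∀ N d → 45 * (N * N) + d * (90 * N + 45 * d) ≡ 45 * ((N + d) * (N + d))
  expand-left = solve-∀
  expand-right : ∀ X d → (X + 5 * d) * (X + 5 * d) ≡ X * X + d * (10 * X + 25 * d)
  expand-right = solve-∀
  25d≤45d : 25 * d ≤ 45 * d
  25d≤45d = *-monoˡ-≤ d (m≤m+n 25 20)
  10X≤90N : 10 * X ≤ 90 * N
  10X≤90N = begin
    10 * X       ≤⟨ *-monoʳ-≤ 10 (<⇒≤ (≰⇒> 7N≰X)) ⟩
    10 * (7 * N) ≡⟨ sym (*-assoc 10 7 N) ⟩
    70 * N       ≤⟨ *-monoˡ-≤ N (m≤m+n 70 20) ⟩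
    90 * N       ∎

slopeBound-antitone : ∀ {N N′ L} → N ≤ N′ → SlopeBound N′ L → SlopeBound N L
slopeBound-antitone {N} {L = L} N≤N′ bound with m≤n⇒∃[o]m+o≡n N≤N′
... | d , refl = √45-bound-descends N d (10 * L + 5 * N)
                   (subst (λ Y → 45 * ((N + d) * (N + d)) ≤ Y * Y) (shift L N d) bound)
  where
  shift : ∀ L N d → 10 * L + 5 * (N + d) ≡ (10 * L + 5 * N) + 5 * d
  shift = solve-∀

-- With N = x + 3y and Z = 10x + 5N, 45N² - Z² = 180 (y² - x(y+x)), which Cassini makes ±180.
slopeBound-cassini-identity : ∀ x y →
  45 * ((((y + x) + y) + y) * (((y + x) + y) + y)) + 180 * (x * (y + x))
  ≡ (10 * x + 5 * (((y + x) + y) + y)) * (10 * x + 5 * (((y + x) + y) + y)) + 180 * (y * y)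
slopeBound-cassini-identity = solve-∀

slopeBound-odd : ∀ {x y} → Cassini true x y → SlopeBound (((y + x) + y) + y) x
slopeBound-odd {x} {y} h = subst (45 * (N * N) ≤_) gap (m≤m+n (45 * (N * N)) 180)
  where
  open ≡-Reasoning
  N = ((y + x) + y) + y
  Z = 10 * x + 5 * N
  collect : ∀ a b → a + 180 + 180 * b ≡ a + 180 * (b + 1)
  collect = solve-∀
  gap : 45 * (N * N) + 180 ≡ Z * Z
  gap = +-cancelʳ-≡ (180 * (y * y)) _ _ (begin
    45 * (N * N) + 180 + 180 * (y * y)   ≡⟨ collect (45 * (N * N)) (y * y) ⟩
    45 * (N * N) + 180 * (y * y + 1)     ≡⟨ cong (λ w → 45 * (N * N) + 180 * w) (sym h) ⟩
    45 * (N * N) + 180 * (x * (y + x))   ≡⟨ slopeBound-cassini-identity x y ⟩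
    Z * Z + 180 * (y * y)                ∎)

slopeBound-even : ∀ {x y} → Cassini false x y → 0 < y → SlopeBound (((y + x) + y) + y) (suc x)
slopeBound-even {x} {y} h 0<y = begin
  45 * (N * N)                                 ≡⟨ gap ⟩
  Z * Z + 180                                  ≤⟨ +-monoʳ-≤ (Z * Z) (+-monoˡ-≤ 100 (*-monoʳ-≤ 20 4≤Z)) ⟩
  Z * Z + (20 * Z + 100)                       ≡⟨ expand x N ⟩
  (10 * suc x + 5 * N) * (10 * suc x + 5 * N)  ∎
  where
  open ≤-Reasoning
  N = ((y + x) + y) + y
  Z = 10 * x + 5 * N
  collect : ∀ a b → a + 180 * (b + 1) ≡ a + 180 + 180 * b
  collect = solve-∀
  expand : ∀ x N → (10 * x + 5 * N) * (10 * x + 5 * N) + (20 * (10 * x + 5 * N) + 100)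
                   ≡ (10 * suc x + 5 * N) * (10 * suc x + 5 * N)
  expand = solve-∀
  gap : 45 * (N * N) ≡ Z * Z + 180
  gap = +-cancelʳ-≡ (180 * (x * (y + x))) _ _ (begin-equality
    45 * (N * N) + 180 * (x * (y + x))       ≡⟨ slopeBound-cassini-identity x y ⟩
    Z * Z + 180 * (y * y)                    ≡⟨ cong (λ w → Z * Z + 180 * w) (sym h) ⟩
    Z * Z + 180 * (x * (y + x) + 1)          ≡⟨ collect (Z * Z) (x * (y + x)) ⟩
    Z * Z + 180 + 180 * (x * (y + x))        ∎)
  4≤Z : 4 ≤ Z
  4≤Z = ≤-trans (m≤n+m 4 1)
          (≤-trans (*-monoʳ-≤ 5 (≤-trans 0<y (m≤n+m y (y + x + y)))) (m≤n+m (5 * N) (10 * x)))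

slopeBound⇒boundHolds : ∀ {N L M} → SlopeBound N L → L < M → BoundHolds N M
slopeBound⇒boundHolds {N} {L} {suc M} bound (s≤s L≤M) =
  subst (10 ≤_) (sym (peel M N)) (m≤m+n 10 _) ,
  subst (λ A → 45 * (N * N) ≤ A * A) (sym A∸10) (≤-trans bound (*-mono-≤ 10L+5N≤ 10L+5N≤))
  where
  peel : ∀ M N → 10 * suc M + 5 * N ≡ 10 + (10 * M + 5 * N)
  peel = solve-∀
  A∸10 : (10 * suc M + 5 * N) ∸ 10 ≡ 10 * M + 5 * N
  A∸10 = trans (cong (_∸ 10) (peel M N)) (m+n∸m≡n 10 _)
  10L+5N≤ : 10 * L + 5 * N ≤ 10 * M + 5 * N
  10L+5N≤ = +-monoˡ-≤ (5 * N) (*-monoʳ-≤ 10 L≤M)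

bracket : ∀ (f : ℕ → ℕ) → (∀ b → f b < f (suc b)) → ∀ {N} → f 0 < N →
          ∃ λ b → f b < N × N ≤ f (suc b)
bracket f increasing {suc n} f0<1+n with m≤n⇒m<n∨m≡n (s≤s⁻¹ f0<1+n)
... | inj₂ refl = 0 , ≤-refl , increasing 0
... | inj₁ f0<n with bracket f increasing f0<n
...   | b , fb<n , n≤fb′ with m≤n⇒m<n∨m≡n n≤fb′
...     | inj₁ n<fb′ = b , m<n⇒m<1+n fb<n , n<fb′
...     | inj₂ refl  = suc b , ≤-refl , increasing (suc b)

SZ-conflicts : ∀ b → ∃ λ L → (∀ {N} → conflictEnd b < N → ∃₂ (ConflictAt SZ N L)) ×
                             SlopeBound (conflictEnd (suc b)) L
SZ-conflicts b with odd (2 + b) in parity | cassini (2 + b)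
... | true  | c = fib (2 + b) ,
                  (λ end<N → _ , _ , SZ-conflict b end<N) ,
                  slopeBound-odd {fib (2 + b)} {fib (3 + b)} c
... | false | c = suc (fib (2 + b)) ,
                  (λ end<N → _ , _ , SZ-conflict-extended b parity end<N) ,
                  slopeBound-even {fib (2 + b)} {fib (3 + b)} c (fib-pos (2 + b))

theorem1p1 : Σ ℕ λ N₀ → 0 < N₀ × (∀ N → N₀ < N → Σ ℕ λ M → IsMOC SZ N M × BoundHolds N M)
theorem1p1 = 4 , s≤s z≤n , λ N 4<N →
  let b , end<N , N≤end′  = bracket conflictEnd conflictEnd-increasing 4<N
      L , conflicts , slope = SZ-conflicts b
      _ , _ , c             = conflicts end<N
      M , 1≤M , gen , least = least-generating-order SZ N
      2<N                   = ≤-trans (s≤s (s≤s (s≤s z≤n))) 4<N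
  in M , inj₂ (SZ-nonconstant 2<N , 1≤M , gen , least) ,
     slopeBound⇒boundHolds {N} (slopeBound-antitone {N} {L = L} N≤end′ slope) (conflict⇒order> c gen)
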